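{- Let $B$ be a nontrivial Boolean algebra and $\langle f,g\rangle$ a decomposing pair on $B$. If $f$ and $g$ are dual pseudocomplements of each other (i.e. $g=f^\bot$ and $f=g^\bot$), then $\langle f,g\rangle$ is a minimal element of $\mathrm{Dec}(B)$. If $B$ is complete, then conversely every minimal element $\langle f,g\rangle$ of $\mathrm{Dec}(B)$ has $f$ and $g$ dual pseudocomplements of each other.
   Context: A modal operator on $B$ is $f:B\to B$ with $f(0)=0$, $f(x+y)=f(x)+f(y)$; modal operators are ordered pointwise with join $(f\lor g)(x)=f(x)+g(x)$ and top the unary discriminator $f^{\mathbf 1}$ ($f^{\mathbf 1}(0)=0$, $f^{\mathbf 1}(x)=1$ for $x\neq 0$). A decomposing pair is a pair $\langle f,g\rangle$ of modal operators with $f(x)+g(x)=1$ for all $x\neq0$; $\mathrm{Dec}(B)$ is the set of decomposing pairs ordered by $\langle f,g\rangle\le\langle f',g'\rangle$ iff $f\le f'$ and $g\le g'$. The dual pseudocomplement $f^\bot$ of $f$ is the least modal operator $g$ with $f\lor g=f^{\mathbf 1}$. -}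

module Defs where

open import Level using (Level; _⊔_; suc)
open import Data.Product using (_×_; Σ)
open import Relation.Nullary using (¬_)
open import Algebra.Lattice.Bundles using (BooleanAlgebra)

module _ {c ℓ : Level} (B : BooleanAlgebra c ℓ) where
  open BooleanAlgebra B hiding (¬_)

  Nontrivial : Set ℓ
  Nontrivial = ¬ (⊤ ≈ ⊥)

  _≤B_ : Carrier → Carrier → Set ℓ
  x ≤B y = x ∨ y ≈ y

  Complete : Set (suc (c ⊔ ℓ))
  Complete = (P : Carrier → Set (c ⊔ ℓ)) →
    Σ Carrier λ s → (∀ x → P x → x ≤B s) × (∀ u → (∀ x → P x → x ≤B u) → s ≤B u)

  record IsModal (f : Carrier → Carrier) : Set (c ⊔ ℓ) where
    field
      cong     : ∀ {x y} → x ≈ y → f x ≈ f y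
      normal   : f ⊥ ≈ ⊥
      additive : ∀ x y → f (x ∨ y) ≈ f x ∨ f y

  _≤ₘ_ : (Carrier → Carrier) → (Carrier → Carrier) → Set (c ⊔ ℓ)
  f ≤ₘ g = ∀ x → f x ≤B g x

  _≐_ : (Carrier → Carrier) → (Carrier → Carrier) → Set (c ⊔ ℓ)
  f ≐ g = ∀ x → f x ≈ g x

  _∨ₘ_ : (Carrier → Carrier) → (Carrier → Carrier) → (Carrier → Carrier)
  (f ∨ₘ g) x = f x ∨ g x

  IsUnaryDiscriminator : (Carrier → Carrier) → Set (c ⊔ ℓ)
  IsUnaryDiscriminator d = ∀ x → (x ≈ ⊥ → d x ≈ ⊥) × (¬ (x ≈ ⊥) → d x ≈ ⊤)

  IsDecomposingPair : (Carrier → Carrier) → (Carrier → Carrier) → Set (c ⊔ ℓ)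
  IsDecomposingPair f g =
    IsModal f × IsModal g × (∀ x → ¬ (x ≈ ⊥) → f x ∨ g x ≈ ⊤)

  IsMinimalDec : (Carrier → Carrier) → (Carrier → Carrier) → Set (c ⊔ ℓ)
  IsMinimalDec f g = IsDecomposingPair f g ×
    (∀ f' g' → IsDecomposingPair f' g' → f' ≤ₘ f → g' ≤ₘ g → (f ≐ f') × (g ≐ g'))

  IsDualPseudocomplementOf : (Carrier → Carrier) → (Carrier → Carrier) → Set (c ⊔ ℓ)
  IsDualPseudocomplementOf g f = IsModal g × IsUnaryDiscriminator (f ∨ₘ g) ×
    (∀ h → IsModal h → IsUnaryDiscriminator (f ∨ₘ h) → g ≤ₘ h)

-- If f and g are dual pseudocomplements of each other and ⟨f', g'⟩ ≤ ⟨f, g⟩ is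
-- decomposing, then f ∨ g' already covers every nonzero element, so g ≤ g' by
-- leastness of g = f^⊥; symmetrically f ≤ f'.  Conversely, in a complete Boolean
-- algebra every modal f has the dual pseudocomplement
--   f^⊥ x = ⋁ { ¬ f y | y ≠ 0, y ≤ x },
-- and if ⟨f, g⟩ is minimal then ⟨f, f^⊥⟩ ≤ ⟨f, g⟩ is decomposing, so g = f^⊥.
module Submission where

open import Defs
open import Level using (Level; _⊔_; Lift; lift; lower)
open import Data.Product using (_×_; _,_; proj₁; proj₂; Σ)
open import Function using (case_of_)
open import Algebra.Lattice.Bundles using (BooleanAlgebra)
open import Axiom.ExcludedMiddle using (ExcludedMiddle)
open import Relation.Nullary using (Dec; yes; no; contradiction)
open import Relation.Nullary.Decidable using (map′)
open import Relation.Binary.Lattice using (IsLattice; Lattice)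
import Algebra.Lattice.Properties.BooleanAlgebra as BooleanAlgebraProperties
import Relation.Binary.Lattice.Properties.JoinSemilattice as JoinSemilatticeProperties
import Relation.Binary.Reasoning.Setoid as SetoidReasoning
import Relation.Binary.Reasoning.PartialOrder as PosetReasoning

module _ {c ℓ : Level} (B : BooleanAlgebra c ℓ) where
  open BooleanAlgebra B
  open BooleanAlgebraProperties B using (∨-idem; ∨-identityˡ; ∨-zeroʳ)

  private
    Op : Set c
    Op = Carrier → Carrier

    infix 4 _≤_
    _≤_ : Carrier → Carrier → Set ℓ
    _≤_ = _≤B_ B

  ≤B-isLattice : IsLattice _≈_ _≤_ _∨_ _∧_
  ≤B-isLattice = record
    { isPartialOrder = record
      { isPreorder = record
        { isEquivalence = isEquivalence
        ; reflexive     = λ {x} {y} x≈y → trans (∨-cong x≈y refl) (∨-idem y)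
        ; trans         = ≤-trans
        }
      ; antisym = λ {x} {y} x≤y y≤x → trans (sym y≤x) (trans (∨-comm y x) x≤y)
      }
    ; supremum = λ x y → x≤x∨y x y , ≤-respʳ (∨-comm y x) (x≤x∨y y x) , ∨-least x y
    ; infimum  = λ x y → x∧y≤x x y , ≤-respˡ (∧-comm y x) (x∧y≤x y x) , ∧-greatest x y
    }
    where
    open SetoidReasoning setoid

    ≤-trans : ∀ {x y z} → x ≤ y → y ≤ z → x ≤ z
    ≤-trans {x} {y} {z} x≤y y≤z = begin
      x ∨ z       ≈⟨ ∨-cong refl (sym y≤z) ⟩
      x ∨ (y ∨ z) ≈⟨ sym (∨-assoc x y z) ⟩
      (x ∨ y) ∨ z ≈⟨ ∨-cong x≤y refl ⟩
      y ∨ z       ≈⟨ y≤z ⟩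
      z           ∎

    ≤-respˡ : ∀ {x x' y} → x ≈ x' → x ≤ y → x' ≤ y
    ≤-respˡ x≈x' x≤y = trans (∨-cong (sym x≈x') refl) x≤y

    ≤-respʳ : ∀ {x y y'} → y ≈ y' → x ≤ y → x ≤ y'
    ≤-respʳ y≈y' x≤y = trans (∨-cong refl (sym y≈y')) (trans x≤y y≈y')

    x≤x∨y : ∀ x y → x ≤ x ∨ y
    x≤x∨y x y = trans (sym (∨-assoc x x y)) (∨-cong (∨-idem x) refl)

    ∨-least : ∀ x y z → x ≤ z → y ≤ z → x ∨ y ≤ z
    ∨-least x y z x≤z y≤z = trans (∨-assoc x y z) (trans (∨-cong refl y≤z) x≤z)

    x∧y≤x : ∀ x y → x ∧ y ≤ x
    x∧y≤x x y = trans (∨-comm (x ∧ y) x) (∨-absorbs-∧ x y)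

    ∧-greatest : ∀ x y z → z ≤ x → z ≤ y → z ≤ x ∧ y
    ∧-greatest x y z z≤x z≤y = begin
      z ∨ (x ∧ y)       ≈⟨ ∨-distribˡ-∧ z x y ⟩
      (z ∨ x) ∧ (z ∨ y) ≈⟨ ∧-cong z≤x z≤y ⟩
      x ∧ y             ∎

  ≤B-lattice : Lattice c ℓ ℓ
  ≤B-lattice = record { isLattice = ≤B-isLattice }

  open Lattice ≤B-lattice
    using (poset; joinSemilattice; x≤x∨y; y≤x∨y; ∨-least; x∧y≤x; x∧y≤y; ∧-greatest; ≤-respˡ-≈)
    renaming (refl to ≤-refl; reflexive to ≤-reflexive; trans to ≤-trans; antisym to ≤-antisym)
  open JoinSemilatticeProperties joinSemilattice using (∨-monotonic)
  open PosetReasoning poset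

  x≤⊤ : ∀ x → x ≤ ⊤
  x≤⊤ = ∨-zeroʳ

  ⊥≤x : ∀ x → ⊥ ≤ x
  ⊥≤x = ∨-identityˡ

  x≤⊥⇒x≈⊥ : ∀ {x} → x ≤ ⊥ → x ≈ ⊥
  x≤⊥⇒x≈⊥ {x} x≤⊥ = ≤-antisym x≤⊥ (⊥≤x x)

  ⊤≤x⇒x≈⊤ : ∀ {x} → ⊤ ≤ x → x ≈ ⊤
  ⊤≤x⇒x≈⊤ {x} ⊤≤x = ≤-antisym (x≤⊤ x) ⊤≤x

  ≤⇒∧≈ : ∀ {x y} → x ≤ y → x ∧ y ≈ x
  ≤⇒∧≈ x≤y = ≤-antisym (x∧y≤x _ _) (∧-greatest ≤-refl x≤y)

  ≤-∨-disjointˡ : ∀ {x y z} → y ≤ x ∨ z → y ∧ x ≈ ⊥ → y ≤ z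
  ≤-∨-disjointˡ {x} {y} {z} y≤x∨z y∧x≈⊥ = ≤-respˡ-≈ y∧z≈y (x∧y≤y y z)
    where
    y∧z≈y : y ∧ z ≈ y
    y∧z≈y = begin-equality
      y ∧ z             ≈⟨ sym (∨-identityˡ _) ⟩
      ⊥ ∨ (y ∧ z)       ≈⟨ ∨-cong (sym y∧x≈⊥) refl ⟩
      (y ∧ x) ∨ (y ∧ z) ≈⟨ sym (∧-distribˡ-∨ y x z) ⟩
      y ∧ (x ∨ z)       ≈⟨ ≤⇒∧≈ y≤x∨z ⟩
      y                 ∎

  ∨≈⊤⇒¬≤ : ∀ {x y} → x ∨ y ≈ ⊤ → ¬ x ≤ y
  ∨≈⊤⇒¬≤ {x} x∨y≈⊤ =
    ≤-∨-disjointˡ (≤-trans (x≤⊤ (¬ x)) (≤-reflexive (sym x∨y≈⊤))) (∧-complementˡ x)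

  ¬-antitone : ∀ {x y} → x ≤ y → ¬ y ≤ ¬ x
  ¬-antitone {x} x≤y = ∨≈⊤⇒¬≤ (⊤≤x⇒x≈⊤ (begin
    ⊤       ≈⟨ sym (∨-complementʳ x) ⟩
    x ∨ ¬ x ≤⟨ ∨-monotonic x≤y ≤-refl ⟩
    _ ∎))

  modal-monotone : ∀ {f} → IsModal B f → ∀ {x y} → x ≤ y → f x ≤ f y
  modal-monotone mf {x} {y} x≤y = trans (sym (IsModal.additive mf x y)) (IsModal.cong mf x≤y)

  modal-≈⊥ : ∀ {f} → IsModal B f → ∀ {x} → x ≈ ⊥ → f x ≈ ⊥
  modal-≈⊥ mf x≈⊥ = trans (IsModal.cong mf x≈⊥) (IsModal.normal mf)

  ≤ₘ-antisym : ∀ {f g} → _≤ₘ_ B f g → _≤ₘ_ B g f → _≐_ B f g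
  ≤ₘ-antisym f≤g g≤f x = ≤-antisym (f≤g x) (g≤f x)

  Decomposes : Op → Op → Set (c ⊔ ℓ)
  Decomposes f g = ∀ x → x ≉ ⊥ → f x ∨ g x ≈ ⊤

  Decomposes-swap : ∀ {f g} → Decomposes f g → Decomposes g f
  Decomposes-swap d x x≉⊥ = trans (∨-comm _ _) (d x x≉⊥)

  Decomposes-monoˡ : ∀ {f f' g} → _≤ₘ_ B f f' → Decomposes f g → Decomposes f' g
  Decomposes-monoˡ {f} {f'} {g} f≤f' d x x≉⊥ = ⊤≤x⇒x≈⊤ (begin
    ⊤         ≈⟨ sym (d x x≉⊥) ⟩
    f x ∨ g x  ≤⟨ ∨-monotonic (f≤f' x) ≤-refl ⟩
    f' x ∨ g x ∎)

  decomposing⇒discriminator : ∀ {f g} → IsDecomposingPair B f g →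
    IsUnaryDiscriminator B (_∨ₘ_ B f g)
  decomposing⇒discriminator (mf , mg , d) x =
    (λ x≈⊥ → trans (∨-cong (modal-≈⊥ mf x≈⊥) (modal-≈⊥ mg x≈⊥)) (∨-idem ⊥)) , d x

  discriminator⇒decomposes : ∀ {f g} → IsUnaryDiscriminator B (_∨ₘ_ B f g) →
    Decomposes f g
  discriminator⇒decomposes disc x = proj₂ (disc x)

  dualPseudocomplement-≤ : ∀ {f g f' g'} → IsModal B f → IsDualPseudocomplementOf B g f →
    IsModal B g' → Decomposes f' g' → _≤ₘ_ B f' f → _≤ₘ_ B g g'
  dualPseudocomplement-≤ mf (_ , _ , least) mg' d' f'≤f =
    least _ mg' (decomposing⇒discriminator (mf , mg' , Decomposes-monoˡ f'≤f d'))

  dualPseudocomplements⇒minimal : (f g : Op) → IsDecomposingPair B f g →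
    IsDualPseudocomplementOf B g f → IsDualPseudocomplementOf B f g → IsMinimalDec B f g
  dualPseudocomplements⇒minimal f g dp@(mf , mg , _) g=f⊥ f=g⊥ = dp , minimal
    where
    minimal : ∀ f' g' → IsDecomposingPair B f' g' → _≤ₘ_ B f' f → _≤ₘ_ B g' g →
      _≐_ B f f' × _≐_ B g g'
    minimal _ _ (mf' , mg' , d') f'≤f g'≤g =
        ≤ₘ-antisym (dualPseudocomplement-≤ mg f=g⊥ mf' (Decomposes-swap d') g'≤g) f'≤f
      , ≤ₘ-antisym (dualPseudocomplement-≤ mf g=f⊥ mg' d' f'≤f) g'≤g

  IsMinimalPartner : Op → Op → Set (c ⊔ ℓ)
  IsMinimalPartner f g =
    IsDecomposingPair B f g × (∀ g' → IsDecomposingPair B f g' → _≤ₘ_ B g' g → _≐_ B g g')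

  minimalDec⇒minimalPartnerʳ : ∀ {f g} → IsMinimalDec B f g → IsMinimalPartner f g
  minimalDec⇒minimalPartnerʳ (dp , minimal) =
    dp , λ g' dp' g'≤g → proj₂ (minimal _ g' dp' (λ _ → ≤-refl) g'≤g)

  minimalDec⇒minimalPartnerˡ : ∀ {f g} → IsMinimalDec B f g → IsMinimalPartner g f
  minimalDec⇒minimalPartnerˡ ((mf , mg , d) , minimal) =
      (mg , mf , Decomposes-swap d)
    , λ f' (_ , mf' , d') f'≤f →
        proj₁ (minimal f' _ (mf' , mg , Decomposes-swap d') f'≤f (λ _ → ≤-refl))

  minimalPartner⇒dualPseudocomplement : ∀ {f g g₀} → IsMinimalPartner f g →
    IsDualPseudocomplementOf B g₀ f → IsDualPseudocomplementOf B g f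
  minimalPartner⇒dualPseudocomplement {g = g} {g₀} (dp@(mf , mg , _) , minimal)
                                      (mg₀ , disc₀ , least₀) =
      mg
    , decomposing⇒discriminator dp
    , λ h mh disc x → ≤-respˡ-≈ (sym (g≐g₀ x)) (least₀ h mh disc x)
    where
    g≐g₀ : _≐_ B g g₀
    g≐g₀ = minimal g₀ (mf , mg₀ , discriminator⇒decomposes disc₀)
                   (least₀ g mg (decomposing⇒discriminator dp))

  module _ (em : ExcludedMiddle (c ⊔ ℓ)) (complete : Complete B) where
    private
      ⋁ : (Carrier → Set (c ⊔ ℓ)) → Carrier
      ⋁ P = proj₁ (complete P)

      decide : (P : Set ℓ) → Dec P
      decide P = map′ lower lift (em {Lift c P})

    dualPseudocomplement : Op → Op
    dualPseudocomplement f x = ⋁ λ z → Σ Carrier λ y → y ≉ ⊥ × y ≤ x × z ≈ ¬ f y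

    module _ {f : Op} (mf : IsModal B f) where
      private
        f⊥ : Op
        f⊥ = dualPseudocomplement f

      ¬≤dualPseudocomplement : ∀ {x y} → y ≉ ⊥ → y ≤ x → ¬ f y ≤ f⊥ x
      ¬≤dualPseudocomplement y≉⊥ y≤x = proj₁ (proj₂ (complete _)) _ (_ , y≉⊥ , y≤x , refl)

      dualPseudocomplement-least : ∀ {x u} → (∀ y → y ≉ ⊥ → y ≤ x → ¬ f y ≤ u) → f⊥ x ≤ u
      dualPseudocomplement-least ¬fy≤u = proj₂ (proj₂ (complete _)) _ λ where
        _ (y , y≉⊥ , y≤x , z≈¬fy) → ≤-respˡ-≈ (sym z≈¬fy) (¬fy≤u y y≉⊥ y≤x)

      dualPseudocomplement-monotone : ∀ {x x'} → x ≤ x' → f⊥ x ≤ f⊥ x'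
      dualPseudocomplement-monotone x≤x' =
        dualPseudocomplement-least λ _ y≉⊥ y≤x → ¬≤dualPseudocomplement y≉⊥ (≤-trans y≤x x≤x')

      -- A nonzero y ≤ x ∨ z either misses x, and then lies below z, or meets x
      -- in a nonzero y ∧ x with ¬ f y ≤ ¬ f (y ∧ x).
      dualPseudocomplement-subadditive : ∀ x z → f⊥ (x ∨ z) ≤ f⊥ x ∨ f⊥ z
      dualPseudocomplement-subadditive x z = dualPseudocomplement-least λ y y≉⊥ y≤x∨z →
        case decide (y ∧ x ≈ ⊥) of λ where
          (yes y∧x≈⊥) → ≤-trans (¬≤dualPseudocomplement y≉⊥ (≤-∨-disjointˡ y≤x∨z y∧x≈⊥))
                                (y≤x∨y _ _)
          (no y∧x≉⊥)  → ≤-trans (¬-antitone (modal-monotone mf (x∧y≤x y x)))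
                                (≤-trans (¬≤dualPseudocomplement y∧x≉⊥ (x∧y≤y y x)) (x≤x∨y _ _))

      dualPseudocomplement-isModal : IsModal B f⊥
      dualPseudocomplement-isModal = record
        { cong     = λ x≈y → ≤-antisym (dualPseudocomplement-monotone (≤-reflexive x≈y))
                                       (dualPseudocomplement-monotone (≤-reflexive (sym x≈y)))
        ; normal   = x≤⊥⇒x≈⊥ (dualPseudocomplement-least λ _ y≉⊥ y≤⊥ →
                                  contradiction (x≤⊥⇒x≈⊥ y≤⊥) y≉⊥)
        ; additive = λ x z → ≤-antisym (dualPseudocomplement-subadditive x z)
            (∨-least (dualPseudocomplement-monotone (x≤x∨y x z))
                     (dualPseudocomplement-monotone (y≤x∨y x z)))
        }

      dualPseudocomplement-decomposes : Decomposes f f⊥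
      dualPseudocomplement-decomposes x x≉⊥ = ⊤≤x⇒x≈⊤ (begin
        ⊤             ≈⟨ sym (∨-complementʳ (f x)) ⟩
        f x ∨ ¬ f x   ≤⟨ ∨-monotonic ≤-refl (¬≤dualPseudocomplement x≉⊥ ≤-refl) ⟩
        f x ∨ f⊥ x    ∎)

      dualPseudocomplement-isDualPseudocomplement : IsDualPseudocomplementOf B f⊥ f
      dualPseudocomplement-isDualPseudocomplement =
          dualPseudocomplement-isModal
        , decomposing⇒discriminator
            (mf , dualPseudocomplement-isModal , dualPseudocomplement-decomposes)
        , λ h mh disc x → dualPseudocomplement-least λ y y≉⊥ y≤x →
            ≤-trans (∨≈⊤⇒¬≤ (proj₂ (disc y) y≉⊥)) (modal-monotone mh y≤x)

    minimal⇒dualPseudocomplements : (f g : Op) → IsMinimalDec B f g →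
      IsDualPseudocomplementOf B g f × IsDualPseudocomplementOf B f g
    minimal⇒dualPseudocomplements f g minimal@((mf , mg , _) , _) =
        minimalPartner⇒dualPseudocomplement (minimalDec⇒minimalPartnerʳ minimal)
          (dualPseudocomplement-isDualPseudocomplement mf)
      , minimalPartner⇒dualPseudocomplement (minimalDec⇒minimalPartnerˡ minimal)
          (dualPseudocomplement-isDualPseudocomplement mg)

mainTheorem14 : {c ℓ : Level} (B : BooleanAlgebra c ℓ) → Nontrivial B →
    ((f g : BooleanAlgebra.Carrier B → BooleanAlgebra.Carrier B) →
      IsDecomposingPair B f g →
      IsDualPseudocomplementOf B g f → IsDualPseudocomplementOf B f g →
      IsMinimalDec B f g)
    ×
    (ExcludedMiddle (c ⊔ ℓ) → Complete B →
      (f g : BooleanAlgebra.Carrier B → BooleanAlgebra.Carrier B) →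
      IsMinimalDec B f g →
      IsDualPseudocomplementOf B g f × IsDualPseudocomplementOf B f g)
mainTheorem14 B _ = dualPseudocomplements⇒minimal B , minimal⇒dualPseudocomplements B
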